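{- There are infinitely many three-term arithmetic progressions $N, N+d, N+2d$ (with $N, d$ positive integers) all of whose terms are powerful numbers and whose common difference satisfies $d = 2\sqrt{N} + 1$.
   Context: A positive integer $n$ is called powerful if for every prime $p$ dividing $n$, also $p^2$ divides $n$. -}

module Defs where

open import Data.Nat using (ℕ; _*_; _<_)
open import Data.Nat.Divisibility using (_∣_)
open import Data.Nat.Primality using (Prime)

Powerful : ℕ → Set
Powerful n = 0 < n × (∀ p → Prime p → p ∣ n → p * p ∣ n)
  where open import Data.Product using (_×_)

-- Take N = m², so that N + d = (m + 1)² and N + 2d = (m + 2)² − 2. Squares are
-- powerful, and so is 343 y² = 7³ y²; it therefore suffices that the Pell-type
-- equation x² − 343 y² = 2 has solutions with x arbitrarily large. It has the
-- solution (11427, 617), and multiplying x + y√343 by a unit u + v√343 of norm 1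
-- (Brahmagupta's identity) produces ever larger solutions.
module Submission where

open import Defs
open import Data.Nat using (ℕ; _+_; _*_; _<_)
open import Data.Product using (Σ-syntax; _×_)
open import Relation.Binary.PropositionalEquality using (_≡_)

open import Data.Nat using (suc; z≤n; s≤s; z<s; >-nonZero)
open import Data.Nat.Properties
  using (*-mono-<; m<m*n; m≤m+n; m≤n+m; m≤m*n; ≤-trans; <-≤-trans; +-cancelʳ-≡)
open import Data.Nat.Divisibility using (_∣_; ∣-refl; ∣-trans; m∣m*n; n∣m*n; *-pres-∣)
open import Data.Nat.Primality using (Prime; euclidsLemma)
open import Data.Nat.Tactic.RingSolver using (solve-∀)
open import Data.Product using (_,_)
open import Data.Sum using (inj₁; inj₂)
open import Relation.Binary.PropositionalEquality using (refl; sym; trans; cong₂; subst; module ≡-Reasoning)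

*-pres-powerful : ∀ {m n} → Powerful m → Powerful n → Powerful (m * n)
*-pres-powerful {m} {n} (0<m , pow-m) (0<n , pow-n) = *-mono-< 0<m 0<n , pow-mn
  where
  pow-mn : ∀ p → Prime p → p ∣ m * n → p * p ∣ m * n
  pow-mn p pp p∣mn with euclidsLemma m n pp p∣mn
  ... | inj₁ p∣m = ∣-trans (pow-m p pp p∣m) (m∣m*n n)
  ... | inj₂ p∣n = ∣-trans (pow-n p pp p∣n) (n∣m*n m)

primes∣m∧m*m∣n⇒powerful : ∀ {m n} → 0 < n → m * m ∣ n →
  (∀ p → Prime p → p ∣ n → p ∣ m) → Powerful n
primes∣m∧m*m∣n⇒powerful 0<n m²∣n rad = 0<n , λ p pp p∣n →
  ∣-trans (*-pres-∣ (rad p pp p∣n) (rad p pp p∣n)) m²∣n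

prime∣m*m⇒∣m : ∀ {p} m → Prime p → p ∣ m * m → p ∣ m
prime∣m*m⇒∣m m pp p∣m² with euclidsLemma m m pp p∣m²
... | inj₁ p∣m = p∣m
... | inj₂ p∣m = p∣m

square-powerful : ∀ {m} → 0 < m → Powerful (m * m)
square-powerful {m} 0<m = primes∣m∧m*m∣n⇒powerful (*-mono-< 0<m 0<m) ∣-refl
  (λ p pp → prime∣m*m⇒∣m m pp)

cube-powerful : ∀ {m} → 0 < m → Powerful (m * (m * m))
cube-powerful {m} 0<m =
  primes∣m∧m*m∣n⇒powerful (*-mono-< 0<m (*-mono-< 0<m 0<m)) (n∣m*n m) rad
  where
  rad : ∀ p → Prime p → p ∣ m * (m * m) → p ∣ m
  rad p pp p∣m³ with euclidsLemma m (m * m) pp p∣m³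
  ... | inj₁ p∣m  = p∣m
  ... | inj₂ p∣m² = prime∣m*m⇒∣m m pp p∣m²

-- (x² − Dy²)(u² − Dv²) = (xu + Dyv)² − D(xv + yu)², read in ℕ without subtraction.
brahmagupta : ∀ D c x y u v → x * x ≡ D * (y * y) + c → u * u ≡ D * (v * v) + 1 →
  (x * u + D * (y * v)) * (x * u + D * (y * v)) ≡ D * ((x * v + y * u) * (x * v + y * u)) + c
brahmagupta D c x y u v x²≡ u²≡ = begin
  (x * u + D * (y * v)) * (x * u + D * (y * v))
    ≡⟨ expand-left D x y u v ⟩
  (x * x) * (u * u) + 2 * D * (x * y * u * v) + D * D * (y * y) * (v * v)
    ≡⟨ cong₂ (λ X U → X * U + 2 * D * (x * y * u * v) + D * D * (y * y) * (v * v)) x²≡ u²≡ ⟩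
  (D * (y * y) + c) * (D * (v * v) + 1) + 2 * D * (x * y * u * v) + D * D * (y * y) * (v * v)
    ≡⟨ regroup D c (y * y) (v * v) (x * y * u * v) ⟩
  D * ((D * (y * y) + c) * (v * v) + 2 * (x * y * u * v) + (y * y) * (D * (v * v) + 1)) + c
    ≡⟨ cong₂ (λ X U → D * (X * (v * v) + 2 * (x * y * u * v) + (y * y) * U) + c) (sym x²≡) (sym u²≡) ⟩
  D * ((x * x) * (v * v) + 2 * (x * y * u * v) + (y * y) * (u * u)) + c
    ≡⟨ cong₂ _+_ (collect-right D x y u v) refl ⟩
  D * ((x * v + y * u) * (x * v + y * u)) + c ∎
  where
  open ≡-Reasoning
  expand-left : ∀ D x y u v → (x * u + D * (y * v)) * (x * u + D * (y * v))
    ≡ (x * x) * (u * u) + 2 * D * (x * y * u * v) + D * D * (y * y) * (v * v)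
  expand-left = solve-∀
  regroup : ∀ D c Y V w → (D * Y + c) * (D * V + 1) + 2 * D * w + D * D * Y * V
    ≡ D * ((D * Y + c) * V + 2 * w + Y * (D * V + 1)) + c
  regroup = solve-∀
  collect-right : ∀ D x y u v → D * ((x * x) * (v * v) + 2 * (x * y * u * v) + (y * y) * (u * u))
    ≡ D * ((x * v + y * u) * (x * v + y * u))
  collect-right = solve-∀

unbounded-solutions : ∀ D c u v {x₀ y₀} → u * u ≡ D * (v * v) + 1 → 1 < u →
  x₀ * x₀ ≡ D * (y₀ * y₀) + c → 0 < x₀ → 0 < y₀ →
  ∀ B → Σ[ x ∈ ℕ ] Σ[ y ∈ ℕ ] (B < x × 0 < y × x * x ≡ D * (y * y) + c)
unbounded-solutions D c u v {x₀} {y₀} _ _ x₀²≡ 0<x₀ 0<y₀ 0 = x₀ , y₀ , 0<x₀ , 0<y₀ , x₀²≡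
unbounded-solutions D c u v u²≡ 1<u x₀²≡ 0<x₀ 0<y₀ (suc B)
  with unbounded-solutions D c u v u²≡ 1<u x₀²≡ 0<x₀ 0<y₀ B
... | x@(suc _) , y , B<x , 0<y , x²≡ =
  x * u + D * (y * v) , x * v + y * u ,
  <-≤-trans (s≤s B<x) (≤-trans (m<m*n x u 1<u) (m≤m+n (x * u) (D * (y * v)))) ,
  <-≤-trans (*-mono-< 0<y (<-≤-trans z<s 1<u)) (m≤n+m (y * u) (x * v)) ,
  brahmagupta D c x y u v x²≡ u²≡

-- The unit is 130576328 + 7050459 √343 = (11427 + 617 √343)² / 2.
solutions-343-2 : ∀ B → Σ[ x ∈ ℕ ] Σ[ y ∈ ℕ ] (B < x × 0 < y × x * x ≡ 343 * (y * y) + 2)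
solutions-343-2 = unbounded-solutions 343 2 130576328 7050459 {11427} {617}
  refl (s≤s (s≤s z≤n)) refl z<s z<s

mainTheorem1 : (B : ℕ) → Σ[ N ∈ ℕ ] Σ[ d ∈ ℕ ] Σ[ m ∈ ℕ ]
    (B < N × 0 < N × 0 < d × m * m ≡ N × d ≡ 2 * m + 1
      × Powerful N × Powerful (N + d) × Powerful (N + 2 * d))
mainTheorem1 B with solutions-343-2 (2 + B)
... | suc (suc m) , y , s≤s (s≤s B<m) , 0<y , x²≡ =
  m * m , 2 * m + 1 , m ,
  <-≤-trans B<m (m≤m*n m m {{>-nonZero 0<m}}) , *-mono-< 0<m 0<m , m≤n+m 1 (2 * m) , refl , refl ,
  square-powerful 0<m ,
  subst Powerful (sym (next-square m)) (square-powerful {suc m} z<s) ,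
  subst Powerful (sym N+2d≡) (*-pres-powerful (cube-powerful {7} z<s) (square-powerful 0<y))
  where
  0<m : 0 < m
  0<m = <-≤-trans z<s B<m
  next-square : ∀ m → m * m + (2 * m + 1) ≡ suc m * suc m
  next-square = solve-∀
  square-after-next : ∀ m → (2 + m) * (2 + m) ≡ m * m + 2 * (2 * m + 1) + 2
  square-after-next = solve-∀
  N+2d≡ : m * m + 2 * (2 * m + 1) ≡ 343 * (y * y)
  N+2d≡ = +-cancelʳ-≡ 2 _ _ (trans (sym (square-after-next m)) x²≡)
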